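{- Let $G$ be a finite simple graph with vertex set $\{1,\dots,n\}$ and no isolated vertices, with degree pairs $(d_i,m_i)_{i=1}^n$. Then $$\sum_{i=1}^n m_i^2\geq \sum_{i=1}^n d_i^2,$$ with equality if and only if $m_i=d_i$ for all $i$.
   Context: For a vertex $i$ of $G$, $d_i$ is the degree of $i$ and $m_i=d_i^{ -1}\sum_{j:\, ji\in E(G)} d_j$ is the average of the degrees of the neighbors of $i$ (the average $2$-degree). The sequence $(d_i,m_i)_{i=1}^n$ is called the sequence of degree pairs of $G$. -}

module Defs where

open import Data.Bool using (Bool; true; false; if_then_else_)
open import Data.Nat as ℕ using (ℕ; zero; suc; _>_; NonZero; >-nonZero)
open import Data.Fin using (Fin; zero; suc)
open import Data.Integer using (+_)
open import Data.Rational as ℚ using (ℚ)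
open import Relation.Binary.PropositionalEquality using (_≡_)

record SimpleGraph (n : ℕ) : Set where
  field
    Adj       : Fin n → Fin n → Bool
    symmetric : ∀ i j → Adj i j ≡ Adj j i
    loopless  : ∀ i → Adj i i ≡ false

open SimpleGraph public

Σℕ : ∀ {n} → (Fin n → ℕ) → ℕ
Σℕ {zero}  f = 0
Σℕ {suc n} f = f zero ℕ.+ Σℕ (λ i → f (suc i))

Σℚ : ∀ {n} → (Fin n → ℚ) → ℚ
Σℚ {zero}  f = ℚ.0ℚ
Σℚ {suc n} f = f zero ℚ.+ Σℚ (λ i → f (suc i))

degree : ∀ {n} → SimpleGraph n → Fin n → ℕ
degree G i = Σℕ (λ j → if Adj G i j then 1 else 0)

neighbourDegreeSum : ∀ {n} → SimpleGraph n → Fin n → ℕ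
neighbourDegreeSum G i = Σℕ (λ j → if Adj G i j then degree G j else 0)

NoIsolated : ∀ {n} → SimpleGraph n → Set
NoIsolated G = ∀ i → degree G i > 0

dℚ : ∀ {n} → SimpleGraph n → Fin n → ℚ
dℚ G i = (+ degree G i) ℚ./ 1

avg2deg : ∀ {n} (G : SimpleGraph n) → NoIsolated G → Fin n → ℚ
avg2deg G noIso i =
  ℚ._/_ (+ neighbourDegreeSum G i) (degree G i) {{>-nonZero (noIso i)}}

module Submission where

-- Write d_i for the degree of vertex i and m_i for its average 2-degree,
-- so that m_i d_i = Σ_{j ~ i} d_j.
--
-- (1) Double counting.  Summing the weights of the neighbours over all
--     vertices counts the weight of j once for every neighbour of j, so
--     Σ_i m_i d_i = Σ_i Σ_{j ~ i} d_j = Σ_j d_j · d_j.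
-- (2) Pythagoras.  For rational vectors x, y with Σ x_i y_i = Σ y_i²,
--     Σ x_i² = Σ (x_i − y_i)² + Σ y_i².  Since squares are non-negative and
--     a sum of non-negative terms vanishes only if every term does, this gives
--     Σ y_i² ≤ Σ x_i², with equality exactly when x = y.
-- The theorem is (2) applied to x = m and y = d, whose hypothesis is (1).

open import Defs
open import Data.Nat using (ℕ)
open import Data.Fin using (Fin)
open import Data.Product using (_×_)
open import Data.Rational using (_≤_; _*_)
open import Relation.Binary.PropositionalEquality using (_≡_)
open import Function.Bundles using (_⇔_)

open import Data.Bool using (Bool; true; false; if_then_else_)
open import Data.Fin using (zero; suc)
open import Data.Product using (_,_)
open import Data.Sum using (inj₁; inj₂; [_,_]′)
open import Function.Base using (_∘_)
open import Function.Bundles using (mk⇔)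
open import Relation.Binary.PropositionalEquality
  using (refl; sym; trans; cong; cong₂; module ≡-Reasoning)
import Data.Nat as ℕ
import Data.Nat.Properties as ℕP
open import Data.Integer as ℤ using (+_)
import Data.Integer.Properties as ℤP
import Data.Integer.GCD as ℤGCD
open import Data.Rational as ℚ using (ℚ; 0ℚ; _+_; _-_; _/_; toℚᵘ; fromℚᵘ)
import Data.Rational.Properties as ℚP
import Data.Rational.Unnormalised as ℚᵘ
import Data.Rational.Unnormalised.Properties as ℚᵘP
import Data.Rational.Solver as ℚSolver
import Algebra.Properties.Semiring.Sum as SemiringSum
import Algebra.Properties.CommutativeMonoid.Sum as CommutativeMonoidSum
import Algebra.Properties.Group as GroupProperties

module ℕΣ = SemiringSum ℕP.+-*-semiring
module ℚΣ = CommutativeMonoidSum ℚP.+-0-commutativeMonoid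

Σℕ≡sum : ∀ {n} (f : Fin n → ℕ) → Σℕ f ≡ ℕΣ.sum f
Σℕ≡sum {ℕ.zero}  f = refl
Σℕ≡sum {ℕ.suc n} f = cong (f zero ℕ.+_) (Σℕ≡sum (f ∘ suc))

Σℚ≡sum : ∀ {n} (f : Fin n → ℚ) → Σℚ f ≡ ℚΣ.sum f
Σℚ≡sum {ℕ.zero}  f = refl
Σℚ≡sum {ℕ.suc n} f = cong (_+_ (f zero)) (Σℚ≡sum (f ∘ suc))

Σℚ-cong : ∀ {n} {f g : Fin n → ℚ} → (∀ i → f i ≡ g i) → Σℚ f ≡ Σℚ g
Σℚ-cong {f = f} {g} f≗g =
  trans (Σℚ≡sum f) (trans (ℚΣ.sum-cong-≗ f≗g) (sym (Σℚ≡sum g)))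

Σℚ-+ : ∀ {n} (f g : Fin n → ℚ) → Σℚ (λ i → f i + g i) ≡ Σℚ f + Σℚ g
Σℚ-+ f g = begin
  Σℚ (λ i → f i + g i)         ≡⟨ Σℚ≡sum (λ i → f i + g i) ⟩
  ℚΣ.sum (λ i → f i + g i)     ≡⟨ ℚΣ.∑-distrib-+ f g ⟩
  ℚΣ.sum f + ℚΣ.sum g          ≡⟨ sym (cong₂ _+_ (Σℚ≡sum f) (Σℚ≡sum g)) ⟩
  Σℚ f + Σℚ g                  ∎
  where open ≡-Reasoning

Σℚ-nonneg : ∀ {n} (f : Fin n → ℚ) → (∀ i → 0ℚ ≤ f i) → 0ℚ ≤ Σℚ f
Σℚ-nonneg {ℕ.zero}  f f≥0 = ℚP.≤-refl
Σℚ-nonneg {ℕ.suc n} f f≥0 =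
  ℚP.+-mono-≤ (f≥0 zero) (Σℚ-nonneg (f ∘ suc) (f≥0 ∘ suc))

term≤Σℚ : ∀ {n} (f : Fin n → ℚ) → (∀ i → 0ℚ ≤ f i) → ∀ i → f i ≤ Σℚ f
term≤Σℚ f f≥0 zero = ℚP.≤-trans
  (ℚP.≤-reflexive (sym (ℚP.+-identityʳ (f zero))))
  (ℚP.+-monoʳ-≤ (f zero) (Σℚ-nonneg (f ∘ suc) (f≥0 ∘ suc)))
term≤Σℚ f f≥0 (suc i) = ℚP.≤-trans
  (term≤Σℚ (f ∘ suc) (f≥0 ∘ suc) i)
  (ℚP.≤-trans (ℚP.≤-reflexive (sym (ℚP.+-identityˡ _))) (ℚP.+-monoˡ-≤ _ (f≥0 zero)))

Σℚ-nonneg-zero : ∀ {n} (f : Fin n → ℚ) → (∀ i → 0ℚ ≤ f i) →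
                 Σℚ f ≡ 0ℚ → ∀ i → f i ≡ 0ℚ
Σℚ-nonneg-zero f f≥0 Σf≡0 i =
  ℚP.≤-antisym (ℚP.≤-trans (term≤Σℚ f f≥0 i) (ℚP.≤-reflexive Σf≡0)) (f≥0 i)

-- Double counting.  The 0/1 adjacency indicator turns "w j if j ~ i" into
-- a product, and its symmetry lets us swap the roles of i and j.

indicator : Bool → ℕ
indicator b = if b then 1 else 0

select≡scale : ∀ (b : Bool) (w : ℕ) → (if b then w else 0) ≡ w ℕ.* indicator b
select≡scale true  w = sym (ℕP.*-identityʳ w)
select≡scale false w = sym (ℕP.*-zeroʳ w)

Σ-neighbour-weights : ∀ {n} (G : SimpleGraph n) (w : Fin n → ℕ) →
  Σℕ (λ i → Σℕ (λ j → if Adj G i j then w j else 0))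
    ≡ Σℕ (λ j → w j ℕ.* degree G j)
Σ-neighbour-weights G w = begin
  Σℕ (λ i → Σℕ (neighbourWeight i))           ≡⟨ Σℕ≡sum (λ i → Σℕ (neighbourWeight i)) ⟩
  sum (λ i → Σℕ (neighbourWeight i))          ≡⟨ sum-cong-≗ (λ i → Σℕ≡sum (neighbourWeight i)) ⟩
  sum (λ i → sum (neighbourWeight i))         ≡⟨ sum-cong-≗ (λ i → sum-cong-≗ (selected i)) ⟩
  sum (λ i → sum (λ j → edgeWeight i j))      ≡⟨ ∑-comm edgeWeight ⟩
  sum (λ j → sum (λ i → edgeWeight i j))      ≡⟨ sum-cong-≗ (λ j → sum-cong-≗ (λ i → adj-symmetric i j)) ⟩
  sum (λ j → sum (λ i → w j ℕ.* adj j i))     ≡⟨ sum-cong-≗ (λ j → sym (*-distribˡ-sum (w j) (adj j))) ⟩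
  sum (λ j → w j ℕ.* sum (adj j))             ≡⟨ sum-cong-≗ (λ j → cong (w j ℕ.*_) (sym (Σℕ≡sum (adj j)))) ⟩
  sum (λ j → w j ℕ.* degree G j)              ≡⟨ sym (Σℕ≡sum (λ j → w j ℕ.* degree G j)) ⟩
  Σℕ (λ j → w j ℕ.* degree G j)               ∎
  where
  open ≡-Reasoning
  open ℕΣ using (sum; sum-cong-≗; ∑-comm; *-distribˡ-sum)
  adj : Fin _ → Fin _ → ℕ
  adj i j = indicator (Adj G i j)
  neighbourWeight edgeWeight : Fin _ → Fin _ → ℕ
  neighbourWeight i j = if Adj G i j then w j else 0
  edgeWeight i j = w j ℕ.* adj i j
  selected : ∀ i j → neighbourWeight i j ≡ edgeWeight i j
  selected i j = select≡scale (Adj G i j) (w j)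
  adj-symmetric : ∀ i j → edgeWeight i j ≡ w j ℕ.* adj j i
  adj-symmetric i j = cong (λ b → w j ℕ.* indicator b) (symmetric G i j)

Σ-neighbourDegreeSum : ∀ {n} (G : SimpleGraph n) →
  Σℕ (neighbourDegreeSum G) ≡ Σℕ (λ j → degree G j ℕ.* degree G j)
Σ-neighbourDegreeSum G = Σ-neighbour-weights G (degree G)

-- The embedding ℕ → ℚ used by Defs (dℚ G i = ι (degree G i)) is a
-- semiring homomorphism, and dividing by a nonzero d is undone by
-- multiplying by ι d.  Everything is computed via unnormalised rationals:
-- + a / suc k is fromℚᵘ (mkℚᵘ (+ a) k), and fromℚᵘ respects + and *.

ιᵘ : ℕ → ℚᵘ.ℚᵘ
ιᵘ a = ℚᵘ.mkℚᵘ (+ a) 0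

ι : ℕ → ℚ
ι a = fromℚᵘ (ιᵘ a)

fromℚᵘ-homo-+ : ∀ p q → fromℚᵘ (p ℚᵘ.+ q) ≡ fromℚᵘ p + fromℚᵘ q
fromℚᵘ-homo-+ p q = ℚP.toℚᵘ-injective (begin
  toℚᵘ (fromℚᵘ (p ℚᵘ.+ q))               ≈⟨ ℚP.toℚᵘ-fromℚᵘ (p ℚᵘ.+ q) ⟩
  p ℚᵘ.+ q                               ≈⟨ ℚᵘP.+-cong (ℚᵘP.≃-sym (ℚP.toℚᵘ-fromℚᵘ p))
                                                       (ℚᵘP.≃-sym (ℚP.toℚᵘ-fromℚᵘ q)) ⟩
  toℚᵘ (fromℚᵘ p) ℚᵘ.+ toℚᵘ (fromℚᵘ q)   ≈⟨ ℚᵘP.≃-sym (ℚP.toℚᵘ-homo-+ (fromℚᵘ p) (fromℚᵘ q)) ⟩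
  toℚᵘ (fromℚᵘ p + fromℚᵘ q)             ∎)
  where open ℚᵘP.≃-Reasoning

fromℚᵘ-homo-* : ∀ p q → fromℚᵘ (p ℚᵘ.* q) ≡ fromℚᵘ p * fromℚᵘ q
fromℚᵘ-homo-* p q = ℚP.toℚᵘ-injective (begin
  toℚᵘ (fromℚᵘ (p ℚᵘ.* q))               ≈⟨ ℚP.toℚᵘ-fromℚᵘ (p ℚᵘ.* q) ⟩
  p ℚᵘ.* q                               ≈⟨ ℚᵘP.*-cong (ℚᵘP.≃-sym (ℚP.toℚᵘ-fromℚᵘ p))
                                                       (ℚᵘP.≃-sym (ℚP.toℚᵘ-fromℚᵘ q)) ⟩
  toℚᵘ (fromℚᵘ p) ℚᵘ.* toℚᵘ (fromℚᵘ q)   ≈⟨ ℚᵘP.≃-sym (ℚP.toℚᵘ-homo-* (fromℚᵘ p) (fromℚᵘ q)) ⟩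
  toℚᵘ (fromℚᵘ p * fromℚᵘ q)             ∎)
  where open ℚᵘP.≃-Reasoning

-- In ℚᵘ the sum and product of a/1 and b/1 are (a+b)/1 and (ab)/1 up to ≃;
-- the cross-multiplied numerators agree by ℕ → ℤ being a homomorphism.
ι-+ : ∀ a b → ι (a ℕ.+ b) ≡ ι a + ι b
ι-+ a b = trans (ℚP.fromℚᵘ-cong {ιᵘ (a ℕ.+ b)} {ιᵘ a ℚᵘ.+ ιᵘ b} (ℚᵘ.*≡* numerators))
                (fromℚᵘ-homo-+ (ιᵘ a) (ιᵘ b))
  where
  numerators : + (a ℕ.+ b) ℤ.* + 1 ≡ (+ a ℤ.* + 1 ℤ.+ + b ℤ.* + 1) ℤ.* + 1
  numerators = cong (ℤ._* + 1) (trans (ℤP.pos-+ a b)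
    (sym (cong₂ ℤ._+_ (ℤP.*-identityʳ (+ a)) (ℤP.*-identityʳ (+ b)))))

ι-* : ∀ a b → ι (a ℕ.* b) ≡ ι a * ι b
ι-* a b = trans (ℚP.fromℚᵘ-cong {ιᵘ (a ℕ.* b)} {ιᵘ a ℚᵘ.* ιᵘ b} (ℚᵘ.*≡* numerators))
                (fromℚᵘ-homo-* (ιᵘ a) (ιᵘ b))
  where
  numerators : + (a ℕ.* b) ℤ.* + 1 ≡ (+ a ℤ.* + b) ℤ.* + 1
  numerators = cong (ℤ._* + 1) (ℤP.pos-* a b)

/-*-cancel : ∀ a d .{{_ : ℕ.NonZero d}} → (+ a / d) * ι d ≡ ι a
/-*-cancel a d@(ℕ.suc k) =
  trans (sym (fromℚᵘ-homo-* (ℚᵘ.mkℚᵘ (+ a) k) (ιᵘ d)))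
        (ℚP.fromℚᵘ-cong {ℚᵘ.mkℚᵘ (+ a) k ℚᵘ.* ιᵘ d} {ιᵘ a} (ℚᵘ.*≡* numerators))
  where
  numerators : (+ a ℤ.* + d) ℤ.* + 1 ≡ + a ℤ.* + (d ℕ.* 1)
  numerators = trans (ℤP.*-identityʳ (+ a ℤ.* + d))
                     (cong (λ m → + a ℤ.* + m) (sym (ℕP.*-identityʳ d)))

ι-Σ : ∀ {n} (f : Fin n → ℕ) → ι (Σℕ f) ≡ Σℚ (ι ∘ f)
ι-Σ {ℕ.zero}  f = refl
ι-Σ {ℕ.suc n} f = trans (ι-+ (f zero) (Σℕ (f ∘ suc))) (cong (_+_ (ι (f zero))) (ι-Σ (f ∘ suc)))

Σ-avg2deg·degree : ∀ {n} (G : SimpleGraph n) (noIso : NoIsolated G) →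
  Σℚ (λ i → avg2deg G noIso i * dℚ G i) ≡ Σℚ (λ i → dℚ G i * dℚ G i)
Σ-avg2deg·degree G noIso = begin
  Σℚ (λ i → avg2deg G noIso i * dℚ G i)
    ≡⟨ Σℚ-cong (λ i → /-*-cancel (neighbourDegreeSum G i) (degree G i)
                        {{ℕ.>-nonZero (noIso i)}}) ⟩
  Σℚ (λ i → ι (neighbourDegreeSum G i))       ≡⟨ sym (ι-Σ (neighbourDegreeSum G)) ⟩
  ι (Σℕ (neighbourDegreeSum G))               ≡⟨ cong ι (Σ-neighbourDegreeSum G) ⟩
  ι (Σℕ (λ i → degree G i ℕ.* degree G i))    ≡⟨ ι-Σ (λ i → degree G i ℕ.* degree G i) ⟩
  Σℚ (λ i → ι (degree G i ℕ.* degree G i))    ≡⟨ Σℚ-cong (λ i → ι-* (degree G i) (degree G i)) ⟩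
  Σℚ (λ i → dℚ G i * dℚ G i)                  ∎
  where open ≡-Reasoning

square-nonneg : ∀ x → 0ℚ ≤ x * x
square-nonneg x with ℚP.≤-total 0ℚ x
... | inj₁ 0≤x = ℚP.nonNegative⁻¹ _
  {{ℚP.nonNeg*nonNeg⇒nonNeg x {{ℚ.nonNegative 0≤x}} x {{ℚ.nonNegative 0≤x}}}}
... | inj₂ x≤0 = ℚP.nonNegative⁻¹ _
  {{ℚP.nonPos*nonPos⇒nonPos x {{ℚ.nonPositive x≤0}} x {{ℚ.nonPositive x≤0}}}}

square-zero : ∀ x → x * x ≡ 0ℚ → x ≡ 0ℚ
square-zero x x²≡0 =
  [ ℚP.↥p≡0⇒p≡0 x , ℚP.↥p≡0⇒p≡0 x ]′ (ℤP.i*j≡0⇒i≡0∨j≡0 (ℚ.↥ x) numerator²≡0)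
  where
  -- the numerator of x * x is that of x squared, divided by a gcd
  g : ℤ.ℤ
  g = ℤGCD.gcd (ℚ.↥ x ℤ.* ℚ.↥ x) (ℚ.↧ x ℤ.* ℚ.↧ x)
  numerator²≡0 : ℚ.↥ x ℤ.* ℚ.↥ x ≡ ℤ.0ℤ
  numerator²≡0 = trans (sym (ℚP.↥-* x x))
    (trans (cong (ℤ._* g) (ℚP.p≡0⇒↥p≡0 (x * x) x²≡0)) (ℤP.*-zeroˡ g))

-- Step (2).  Pointwise x² + y² = (x − y)² + 2xy; summing and using
-- Σ xy = Σ y² leaves Σ x² = Σ (x − y)² + Σ y² after cancelling Σ y².
sum-squares-decomposition : ∀ {n} (x y : Fin n → ℚ) →
  Σℚ (λ i → x i * y i) ≡ Σℚ (λ i → y i * y i) →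
  Σℚ (λ i → x i * x i) ≡ Σℚ (λ i → (x i - y i) * (x i - y i)) + Σℚ (λ i → y i * y i)
sum-squares-decomposition {n} x y Σxy≡Σy² =
  ∙-cancelʳ (Σℚ y²) (Σℚ x²) (Σℚ gap + Σℚ y²) (begin
    Σℚ x² + Σℚ y²                     ≡⟨ sym (Σℚ-+ x² y²) ⟩
    Σℚ (λ i → x² i + y² i)            ≡⟨ Σℚ-cong pointwise ⟩
    Σℚ (λ i → gap i + (xy i + xy i))  ≡⟨ Σℚ-+ gap (λ i → xy i + xy i) ⟩
    Σℚ gap + Σℚ (λ i → xy i + xy i)   ≡⟨ cong (_+_ (Σℚ gap)) (Σℚ-+ xy xy) ⟩
    Σℚ gap + (Σℚ xy + Σℚ xy)          ≡⟨ cong (λ s → Σℚ gap + (s + s)) Σxy≡Σy² ⟩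
    Σℚ gap + (Σℚ y² + Σℚ y²)          ≡⟨ sym (ℚP.+-assoc (Σℚ gap) (Σℚ y²) (Σℚ y²)) ⟩
    (Σℚ gap + Σℚ y²) + Σℚ y²          ∎)
  where
  open ≡-Reasoning
  open GroupProperties ℚP.+-0-group using (∙-cancelʳ)
  x² y² xy gap : Fin n → ℚ
  x² i  = x i * x i
  y² i  = y i * y i
  xy i  = x i * y i
  gap i = (x i - y i) * (x i - y i)
  pointwise : ∀ i → x² i + y² i ≡ gap i + (xy i + xy i)
  pointwise i = solve 2 (λ a b → a :* a :+ b :* b := (a :- b) :* (a :- b) :+ (a :* b :+ a :* b))
                        refl (x i) (y i)
    where open ℚSolver.+-*-Solver

sum-squares-comparison : ∀ {n} (x y : Fin n → ℚ) →
  Σℚ (λ i → x i * y i) ≡ Σℚ (λ i → y i * y i) →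
  (Σℚ (λ i → y i * y i) ≤ Σℚ (λ i → x i * x i))
  × ((Σℚ (λ i → x i * x i) ≡ Σℚ (λ i → y i * y i)) ⇔ (∀ i → x i ≡ y i))
sum-squares-comparison x y Σxy≡Σy² = lower-bound , mk⇔ equal-terms equal-sums
  where
  Σx² Σy² : ℚ
  Σx² = Σℚ (λ i → x i * x i)
  Σy² = Σℚ (λ i → y i * y i)
  gap : Fin _ → ℚ
  gap i = (x i - y i) * (x i - y i)
  gap≥0 : ∀ i → 0ℚ ≤ gap i
  gap≥0 i = square-nonneg (x i - y i)
  decomposition : Σx² ≡ Σℚ gap + Σy²
  decomposition = sum-squares-decomposition x y Σxy≡Σy²

  lower-bound : Σy² ≤ Σx²
  lower-bound = ℚP.≤-trans (ℚP.≤-reflexive (sym (ℚP.+-identityˡ Σy²)))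
    (ℚP.≤-trans (ℚP.+-monoˡ-≤ Σy² (Σℚ-nonneg gap gap≥0)) (ℚP.≤-reflexive (sym decomposition)))

  -- if Σ x² = Σ y² the non-negative gaps sum to 0, so each x i − y i is 0
  equal-terms : Σx² ≡ Σy² → ∀ i → x i ≡ y i
  equal-terms Σx²≡Σy² i = begin
    x i               ≡⟨ solve 2 (λ a b → a := (a :- b) :+ b) refl (x i) (y i) ⟩
    (x i - y i) + y i ≡⟨ cong (_+ y i) (square-zero (x i - y i) (Σℚ-nonneg-zero gap gap≥0 Σgap≡0 i)) ⟩
    0ℚ + y i          ≡⟨ ℚP.+-identityˡ (y i) ⟩
    y i               ∎
    where
    open ≡-Reasoning
    open ℚSolver.+-*-Solver
    open GroupProperties ℚP.+-0-group using (∙-cancelʳ)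
    Σgap≡0 : Σℚ gap ≡ 0ℚ
    Σgap≡0 = ∙-cancelʳ Σy² (Σℚ gap) 0ℚ
      (trans (sym decomposition) (trans Σx²≡Σy² (sym (ℚP.+-identityˡ Σy²))))

  equal-sums : (∀ i → x i ≡ y i) → Σx² ≡ Σy²
  equal-sums x≗y = Σℚ-cong (λ i → cong₂ _*_ (x≗y i) (x≗y i))

corollary2p3 : ∀ {n : ℕ} (G : SimpleGraph n) (noIso : NoIsolated G) →
    (Σℚ (λ i → dℚ G i * dℚ G i) ≤ Σℚ (λ i → avg2deg G noIso i * avg2deg G noIso i))
    × ((Σℚ (λ i → avg2deg G noIso i * avg2deg G noIso i) ≡ Σℚ (λ i → dℚ G i * dℚ G i))
       ⇔ (∀ (i : Fin n) → avg2deg G noIso i ≡ dℚ G i))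
corollary2p3 G noIso =
  sum-squares-comparison (avg2deg G noIso) (dℚ G) (Σ-avg2deg·degree G noIso)
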